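{- Let $\mathcal{M}$ be a 3-orbit $(n-1)$-maniplex in class $3^j$ or in class $3^{j,j+1}$. Then every $j$-face of $\mathcal{M}$ is reflexible, i.e. for every $j$-face $F$ the maniplex $\mathcal{M}_F$ has exactly one orbit of flags under its automorphism group.
   Context: An $m$-maniplex is given by a connected simple graph (flag graph), whose vertices are called flags, with a proper edge-colouring by colours $\{0,\dots,m\}$, each colour class a perfect matching, such that for colours $i,j$ with $|i-j|\ge2$ each component of the subgraph spanned by colours $i,j$ is a 4-cycle. Automorphisms are colour-preserving graph automorphisms; a maniplex is reflexible if its automorphism group is transitive on flags, and 3-orbit if it has exactly 3 flag orbits. For an $(n-1)$-maniplex $\mathcal{M}$, a $j$-face $F$ is a connected component of the flag graph with the $j$-edges removed, and $\mathcal{M}_F$ is the $(j-1)$-maniplex obtained by deleting from $F$ the edges of colours $j+1,\dots,n-1$ and taking one connected component (all are isomorphic). The symmetry type graph $T(\mathcal{M})$ has as vertices the flag orbits, an edge of colour $a$ between distinct orbits $B,C$ iff some flag of $B$ is $a$-adjacent to a flag of $C$, and a semi-edge of colour $a$ at $B$ iff some flag of $B$ is $a$-adjacent to a flag of $B$. $\mathcal{M}$ is in class $3^{j,j+1}$ ($j\in\{0,\dots,n-2\}$) if the vertices of $T(\mathcal{M})$ can be named $v_1,v_2,v_3$ so that its only (non-semi) edges are an edge of colour $j$ joining $v_1,v_2$ and an edge of colour $j+1$ joining $v_2,v_3$; it is in class $3^j$ ($j\in\{1,\dots,n-2\}$) if its only edges are an edge of colour $j$ joining $v_1,v_2$ and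 two edges of colours $j-1$ and $j+1$ joining $v_2,v_3$. -}

module Defs where

open import Data.Nat using (ℕ; zero; suc; _+_; _<_; _≤_; ∣_-_∣)
open import Data.Fin using (Fin; toℕ)
open import Data.Fin.Patterns using (0F; 1F; 2F)
open import Data.List using (List; []; _∷_)
open import Data.List.Relation.Unary.All using (All)
open import Data.Product using (Σ; ∃; _×_; _,_)
open import Data.Sum using (_⊎_)
open import Data.Empty using (⊥)
open import Relation.Binary.PropositionalEquality using (_≡_; _≢_)
open import Relation.Nullary using (¬_)
open import Function.Bundles using (_⇔_)

-- A coloured graph on a set of flags with colours Fin n, given by the
-- colour-i neighbour functions (each colour class is a perfect matching).
record FlagGraph (n : ℕ) : Set₁ where
  field
    Flag : Set
    adj  : Fin n → Flag → Flag

module _ {n : ℕ} (G : FlagGraph n) where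
  open FlagGraph G

  walk : List (Fin n) → Flag → Flag
  walk []      x = x
  walk (i ∷ w) x = walk w (adj i x)

  -- G is an (n-1)-maniplex (colours 0,…,n-1)
  record IsManiplex : Set where
    field
      involutive : ∀ i x → adj i (adj i x) ≡ x
      noLoops    : ∀ i x → adj i x ≢ x
      simple     : ∀ i k x → i ≢ k → adj i x ≢ adj k x
      -- for |i-k| ≥ 2 the alternating i,k-walk from x closes after 4 steps
      -- (together with the above, each i,k-component is a 4-cycle)
      fourCycle  : ∀ i k x → 2 ≤ ∣ toℕ i - toℕ k ∣ →
                   adj k (adj i (adj k (adj i x))) ≡ x
      connected  : ∀ x y → ∃ λ (w : List (Fin n)) → walk w x ≡ y

  record Aut : Set where
    field
      fun    : Flag → Flag
      inv    : Flag → Flag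
      inv-l  : ∀ x → inv (fun x) ≡ x
      inv-r  : ∀ x → fun (inv x) ≡ x
      pres   : ∀ i x → fun (adj i x) ≡ adj i (fun x)

  SameOrbit : Flag → Flag → Set
  SameOrbit x y = Σ Aut λ φ → Aut.fun φ x ≡ y

  ThreeOrbitReps : (Fin 3 → Flag) → Set
  ThreeOrbitReps v = (∀ k l → k ≢ l → ¬ SameOrbit (v k) (v l))
                   × (∀ x → Σ (Fin 3) λ k → SameOrbit (v k) x)

  ThreeOrbit : Set
  ThreeOrbit = Σ (Fin 3 → Flag) ThreeOrbitReps

  -- an edge of colour a in the symmetry type graph between the orbits of
  -- v k and v l  (only meaningful for k ≢ l; semi-edges are k ≡ l)
  TEdge : (Fin 3 → Flag) → Fin n → Fin 3 → Fin 3 → Set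
  TEdge v a k l = ∃ λ x → SameOrbit (v k) x × SameOrbit (v l) (adj a x)

  -- allowed edges for class 3^{j,j+1}: colour j between v₁,v₂, colour j+1
  -- between v₂,v₃  (v₁,v₂,v₃ = orbits of v 0F, v 1F, v 2F)
  Allowed-jj1 : ℕ → Fin n → Fin 3 → Fin 3 → Set
  Allowed-jj1 j a 0F 1F = toℕ a ≡ j
  Allowed-jj1 j a 1F 0F = toℕ a ≡ j
  Allowed-jj1 j a 1F 2F = toℕ a ≡ suc j
  Allowed-jj1 j a 2F 1F = toℕ a ≡ suc j
  Allowed-jj1 j a _  _  = ⊥

  Allowed-j : ℕ → Fin n → Fin 3 → Fin 3 → Set
  Allowed-j j a 0F 1F = toℕ a ≡ j
  Allowed-j j a 1F 0F = toℕ a ≡ j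
  Allowed-j j a 1F 2F = (suc (toℕ a) ≡ j) ⊎ (toℕ a ≡ suc j)
  Allowed-j j a 2F 1F = (suc (toℕ a) ≡ j) ⊎ (toℕ a ≡ suc j)
  Allowed-j j a _  _  = ⊥

  Class3jj1 : ℕ → Set
  Class3jj1 j = suc j < n ×
    Σ (Fin 3 → Flag) λ v → ThreeOrbitReps v ×
      (∀ a k l → k ≢ l → (TEdge v a k l ⇔ Allowed-jj1 j a k l))

  Class3j : ℕ → Set
  Class3j j = 1 ≤ j × suc j < n ×
    Σ (Fin 3 → Flag) λ v → ThreeOrbitReps v ×
      (∀ a k l → k ≢ l → (TEdge v a k l ⇔ Allowed-j j a k l))

  -- y is reachable from x using only colours < j; the flags reachable from x
  -- this way form the flag set of M_F, where F is the j-face containing x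
  -- (removing the j-edges and then the edges of colours j+1,…,n-1 leaves
  -- exactly the edges of colours 0,…,j-1).
  Reach : ℕ → Flag → Flag → Set
  Reach j x y = ∃ λ (w : List (Fin n)) → All (λ i → toℕ i < j) w × walk w x ≡ y

  -- an automorphism of M_F (the component C of x under colours < j):
  -- a bijection of C preserving the i-adjacencies for i < j
  record FaceAut (j : ℕ) (x : Flag) : Set where
    field
      fun   : Flag → Flag
      inv   : Flag → Flag
      fun-C : ∀ y → Reach j x y → Reach j x (fun y)
      inv-C : ∀ y → Reach j x y → Reach j x (inv y)
      inv-l : ∀ y → Reach j x y → inv (fun y) ≡ y
      inv-r : ∀ y → Reach j x y → fun (inv y) ≡ y
      pres  : ∀ i y → toℕ i < j → Reach j x y → fun (adj i y) ≡ adj i (fun y)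

  FaceReflexible : ℕ → Flag → Set
  FaceReflexible j x = ∀ y z → Reach j x y → Reach j x z →
    Σ (FaceAut j x) λ φ → FaceAut.fun φ y ≡ z

-- Let Low j be the group of permutations of all flags that commute with the
-- colours 0,…,j-1; a permutation in Low j maps every j-face onto a j-face, so
-- the faces are reflexible as soon as every i-step (i < j) is realised by an
-- element of Low j.  Automorphisms of the maniplex lie in Low j, and so does
-- the colour a matching for every a > j, since a commutes with all colours
-- below j.  In the type graph of a 3-orbit maniplex of class 3^{j,j+1} no
-- edge has a colour below j, and in class 3^j the only such edge (colour
-- j-1) is doubled by an edge of colour j+1; either way an i-step (i < j)
-- either stays inside an orbit or can be replaced by a (j+1)-step.
module Submission where

open import Defs
open import Data.Nat using (ℕ; zero; suc; _<_; _≤_; s≤s; ∣_-_∣)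
open import Data.Nat.Properties using (<⇒≢; ≤-reflexive; ≤-<-trans; m<n⇒m<1+n)
open import Data.Fin using (Fin; toℕ; fromℕ<; _≟_)
open import Data.Fin.Properties using (toℕ-fromℕ<)
open import Data.Fin.Patterns using (0F; 1F; 2F)
open import Data.List using ([]; _∷_; _++_)
open import Data.List.Relation.Unary.All using ([]; _∷_)
open import Data.List.Relation.Unary.All.Properties using (++⁺)
open import Data.Product using (Σ; ∃; _×_; _,_)
open import Data.Sum using (_⊎_; inj₁; inj₂)
open import Data.Empty using (⊥; ⊥-elim)
open import Relation.Binary.PropositionalEquality
open import Relation.Nullary using (¬_; yes; no)
open import Function.Bundles using (_⇔_; Equivalence)

suc-m<n⇒2≤∣m-n∣ : ∀ {m n} → suc m < n → 2 ≤ ∣ m - n ∣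
suc-m<n⇒2≤∣m-n∣ {zero}  p               = p
suc-m<n⇒2≤∣m-n∣ {suc m} (s≤s (s≤s p)) = suc-m<n⇒2≤∣m-n∣ (s≤s p)

module _ {n : ℕ} (M : FlagGraph n) where
  open FlagGraph M

  walk-++ : ∀ u w x → walk M (u ++ w) x ≡ walk M w (walk M u x)
  walk-++ []      w x = refl
  walk-++ (i ∷ u) w x = walk-++ u w (adj i x)

  record LowAut (j : ℕ) : Set where
    field
      fun   : Flag → Flag
      inv   : Flag → Flag
      inv-l : ∀ x → inv (fun x) ≡ x
      inv-r : ∀ x → fun (inv x) ≡ x
      pres  : ∀ i x → toℕ i < j → fun (adj i x) ≡ adj i (fun x)

  open LowAut

  LowRelated : ℕ → Flag → Flag → Set
  LowRelated j x y = Σ (LowAut j) λ h → fun h x ≡ y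

  module _ {j : ℕ} where

    LowAut-id : LowAut j
    LowAut-id = record
      { fun = λ x → x ; inv = λ x → x
      ; inv-l = λ _ → refl ; inv-r = λ _ → refl ; pres = λ _ _ _ → refl }

    LowAut-∘ : LowAut j → LowAut j → LowAut j
    LowAut-∘ g f = record
      { fun   = λ x → fun g (fun f x)
      ; inv   = λ x → inv f (inv g x)
      ; inv-l = λ x → trans (cong (inv f) (inv-l g (fun f x))) (inv-l f x)
      ; inv-r = λ x → trans (cong (fun g) (inv-r f (inv g x))) (inv-r g x)
      ; pres  = λ i x p → trans (cong (fun g) (pres f i x p)) (pres g i (fun f x) p) }

    LowAut-inverse : LowAut j → LowAut j
    LowAut-inverse f = record
      { fun = inv f ; inv = fun f ; inv-l = inv-r f ; inv-r = inv-l f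
      ; pres = λ i y p → begin
          inv f (adj i y)                    ≡⟨ cong (λ q → inv f (adj i q)) (sym (inv-r f y)) ⟩
          inv f (adj i (fun f (inv f y)))    ≡⟨ cong (inv f) (sym (pres f i (inv f y) p)) ⟩
          inv f (fun f (adj i (inv f y)))    ≡⟨ inv-l f _ ⟩
          adj i (inv f y)                    ∎ }
      where open ≡-Reasoning

    Aut⇒LowAut : Aut M → LowAut j
    Aut⇒LowAut φ = record
      { fun = Aut.fun φ ; inv = Aut.inv φ ; inv-l = Aut.inv-l φ ; inv-r = Aut.inv-r φ
      ; pres = λ i x _ → Aut.pres φ i x }

    LowRelated-refl : ∀ {x} → LowRelated j x x
    LowRelated-refl = LowAut-id , refl

    LowRelated-sym : ∀ {x y} → LowRelated j x y → LowRelated j y x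
    LowRelated-sym {x} (h , refl) = LowAut-inverse h , inv-l h x

    LowRelated-trans : ∀ {x y z} → LowRelated j x y → LowRelated j y z → LowRelated j x z
    LowRelated-trans (f , refl) (g , refl) = LowAut-∘ g f , refl

    SameOrbit⇒LowRelated : ∀ {x y} → SameOrbit M x y → LowRelated j x y
    SameOrbit⇒LowRelated (φ , e) = Aut⇒LowAut φ , e

  module _ {j : ℕ} where

    Reach-refl : ∀ {x} → Reach M j x x
    Reach-refl = [] , [] , refl

    Reach-trans : ∀ {x y z} → Reach M j x y → Reach M j y z → Reach M j x z
    Reach-trans {x} (u , pu , refl) (w , pw , refl) = u ++ w , ++⁺ pu pw , walk-++ u w x

    Reach-step : ∀ {i} x → toℕ i < j → Reach M j x (adj i x)
    Reach-step {i} x p = i ∷ [] , p ∷ [] , refl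

    LowAut-preserves-Reach : (h : LowAut j) → ∀ {x y} → Reach M j x y → Reach M j (fun h x) (fun h y)
    LowAut-preserves-Reach h ([] , [] , refl) = Reach-refl
    LowAut-preserves-Reach h {x} (i ∷ w , p ∷ ps , eq) =
      Reach-trans (subst (Reach M j (fun h x)) (sym (pres h i x p)) (Reach-step (fun h x) p))
                  (LowAut-preserves-Reach h (w , ps , eq))

    Reach⇒LowRelated : (∀ w i → toℕ i < j → LowRelated j w (adj i w)) →
                       ∀ {y z} → Reach M j y z → LowRelated j y z
    Reach⇒LowRelated step ([] , [] , refl) = LowRelated-refl
    Reach⇒LowRelated step {y} (i ∷ w , p ∷ ps , eq) =
      LowRelated-trans (step y i p) (Reach⇒LowRelated step (w , ps , eq))

  LowEdgesDoubled : (Fin 3 → Flag) → ℕ → Set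
  LowEdgesDoubled v j = ∀ i k l → toℕ i < j → k ≢ l → TEdge M v i k l →
                        ∃ λ a → j < toℕ a × TEdge M v a k l

  module _ (isM : IsManiplex M) {j : ℕ} where
    open IsManiplex isM

    Reach-sym : ∀ {x y} → Reach M j x y → Reach M j y x
    Reach-sym ([] , [] , refl) = Reach-refl
    Reach-sym {x} (i ∷ w , p ∷ ps , eq) =
      Reach-trans (Reach-sym (w , ps , eq))
                  (subst (Reach M j (adj i x)) (involutive i x) (Reach-step (adj i x) p))

    adj-comm : ∀ i k x → 2 ≤ ∣ toℕ i - toℕ k ∣ → adj k (adj i x) ≡ adj i (adj k x)
    adj-comm i k x far = begin
      adj k (adj i x)                                    ≡⟨ sym (involutive i _) ⟩
      adj i (adj i (adj k (adj i x)))                    ≡⟨ cong (adj i) (sym (involutive k _)) ⟩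
      adj i (adj k (adj k (adj i (adj k (adj i x)))))    ≡⟨ cong (λ q → adj i (adj k q)) (fourCycle i k x far) ⟩
      adj i (adj k x)                                    ∎
      where open ≡-Reasoning

    adj-LowAut : ∀ a → j < toℕ a → LowAut j
    adj-LowAut a j<a = record
      { fun = adj a ; inv = adj a ; inv-l = involutive a ; inv-r = involutive a
      ; pres = λ i x i<j → adj-comm i a x (suc-m<n⇒2≤∣m-n∣ (≤-<-trans i<j j<a)) }

    LowRelated-adj : ∀ a → j < toℕ a → ∀ x → LowRelated j x (adj a x)
    LowRelated-adj a j<a x = adj-LowAut a j<a , refl

    LowAut⇒FaceAut : ∀ {x y} (h : LowAut j) → Reach M j x y → Reach M j x (fun h y) → FaceAut M j x
    LowAut⇒FaceAut {x} {y} h x~y x~hy = record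
      { fun = fun h ; inv = inv h
      ; fun-C = keeps h x~y x~hy
      ; inv-C = keeps (LowAut-inverse h) x~hy (subst (Reach M j x) (sym (inv-l h y)) x~y)
      ; inv-l = λ y _ → inv-l h y ; inv-r = λ y _ → inv-r h y
      ; pres = λ i y p _ → pres h i y p }
      where
      keeps : ∀ (g : LowAut j) {y} → Reach M j x y → Reach M j x (fun g y) →
              ∀ y' → Reach M j x y' → Reach M j x (fun g y')
      keeps g x~y x~gy y' x~y' =
        Reach-trans x~gy (LowAut-preserves-Reach g (Reach-trans (Reach-sym x~y) x~y'))

    FaceReflexible-from-steps : (∀ w i → toℕ i < j → LowRelated j w (adj i w)) →
                                ∀ x → FaceReflexible M j x
    FaceReflexible-from-steps step x y z x~y x~z
      with Reach⇒LowRelated step (Reach-trans (Reach-sym x~y) x~z)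
    ... | h , hy≡z = LowAut⇒FaceAut h x~y (subst (Reach M j x) (sym hy≡z) x~z) , hy≡z

    LowRelated-across-TEdge : ∀ {v a k l w w'} → TEdge M v a k l → j < toℕ a →
                              SameOrbit M (v k) w → SameOrbit M (v l) w' → LowRelated j w w'
    LowRelated-across-TEdge {a = a} (x , vk~x , vl~ax) j<a vk~w vl~w' =
      LowRelated-trans (LowRelated-sym (SameOrbit⇒LowRelated vk~w))
        (LowRelated-trans (SameOrbit⇒LowRelated vk~x)
          (LowRelated-trans (LowRelated-adj a j<a x)
            (LowRelated-trans (LowRelated-sym (SameOrbit⇒LowRelated vl~ax))
              (SameOrbit⇒LowRelated vl~w'))))

    LowRelated-steps : (v : Fin 3 → Flag) → (∀ x → Σ (Fin 3) λ k → SameOrbit M (v k) x) →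
                       LowEdgesDoubled v j → ∀ w i → toℕ i < j → LowRelated j w (adj i w)
    LowRelated-steps v cover doubled w i i<j with cover w | cover (adj i w)
    ... | k , vk~w | l , vl~iw with k ≟ l
    ... | yes refl = LowRelated-trans (LowRelated-sym (SameOrbit⇒LowRelated vk~w))
                                      (SameOrbit⇒LowRelated vl~iw)
    ... | no k≢l with doubled i k l i<j k≢l (w , vk~w , vl~iw)
    ...   | a , j<a , edge = LowRelated-across-TEdge {v = v} edge j<a vk~w vl~iw

  Allowed-j-below : ∀ {j i k l} a → toℕ i < j → toℕ a ≡ suc j →
                    Allowed-j M j i k l → Allowed-j M j a k l
  Allowed-j-below {k = 0F} {1F} a i<j _     i≡j          = ⊥-elim (<⇒≢ i<j i≡j)
  Allowed-j-below {k = 1F} {0F} a i<j _     i≡j          = ⊥-elim (<⇒≢ i<j i≡j)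
  Allowed-j-below {k = 1F} {2F} a i<j a≡j+1 (inj₁ _)     = inj₂ a≡j+1
  Allowed-j-below {k = 1F} {2F} a i<j _     (inj₂ i≡j+1) = ⊥-elim (<⇒≢ (m<n⇒m<1+n i<j) i≡j+1)
  Allowed-j-below {k = 2F} {1F} a i<j a≡j+1 (inj₁ _)     = inj₂ a≡j+1
  Allowed-j-below {k = 2F} {1F} a i<j _     (inj₂ i≡j+1) = ⊥-elim (<⇒≢ (m<n⇒m<1+n i<j) i≡j+1)

  Allowed-jj1-below : ∀ {j i k l} → toℕ i < j → ¬ Allowed-jj1 M j i k l
  Allowed-jj1-below {k = 0F} {1F} i<j i≡j   = <⇒≢ i<j i≡j
  Allowed-jj1-below {k = 1F} {0F} i<j i≡j   = <⇒≢ i<j i≡j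
  Allowed-jj1-below {k = 1F} {2F} i<j i≡j+1 = <⇒≢ (m<n⇒m<1+n i<j) i≡j+1
  Allowed-jj1-below {k = 2F} {1F} i<j i≡j+1 = <⇒≢ (m<n⇒m<1+n i<j) i≡j+1

  Class3j⇒LowEdgesDoubled : ∀ {j v} → suc j < n →
    (∀ a k l → k ≢ l → TEdge M v a k l ⇔ Allowed-j M j a k l) → LowEdgesDoubled v j
  Class3j⇒LowEdgesDoubled {j} j+1<n classify i k l i<j k≢l edge =
    a , ≤-reflexive (sym a≡j+1) ,
    Equivalence.from (classify a k l k≢l)
      (Allowed-j-below a i<j a≡j+1 (Equivalence.to (classify i k l k≢l) edge))
    where
    a : Fin n
    a = fromℕ< j+1<n
    a≡j+1 : toℕ a ≡ suc j
    a≡j+1 = toℕ-fromℕ< j+1<n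

  Class3jj1⇒LowEdgesDoubled : ∀ {j v} →
    (∀ a k l → k ≢ l → TEdge M v a k l ⇔ Allowed-jj1 M j a k l) → LowEdgesDoubled v j
  Class3jj1⇒LowEdgesDoubled classify i k l i<j k≢l edge =
    ⊥-elim (Allowed-jj1-below i<j (Equivalence.to (classify i k l k≢l) edge))

proposition4p4 : (n : ℕ) (M : FlagGraph n) → IsManiplex M → ThreeOrbit M →
    (j : ℕ) → Class3j M j ⊎ Class3jj1 M j →
    ∀ x → FaceReflexible M j x
proposition4p4 n M isM _ j (inj₁ (_ , j+1<n , v , (_ , cover) , classify)) =
  FaceReflexible-from-steps M isM
    (LowRelated-steps M isM v cover (Class3j⇒LowEdgesDoubled M j+1<n classify))
proposition4p4 n M isM _ j (inj₂ (_ , v , (_ , cover) , classify)) =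
  FaceReflexible-from-steps M isM
    (LowRelated-steps M isM v cover (Class3jj1⇒LowEdgesDoubled M classify))
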